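{- Let $T$ be an orientation (tournament) of the complete graph $K_8$. If there exists a vertex $v \in V(T)$ such that $id(v)=2$ or $od(v)=2$, then $\gamma^{*}(T) \leq 4$.
   Context: For a digraph $D=(V,A)$ and $v \in V$, $I(v)=\{u : (u,v)\in A\}$, $O(v)=\{u : (v,u)\in A\}$, $id(v)=|I(v)|$ and $od(v)=|O(v)|$. A subset $S \subseteq V$ is a twin dominating set of $D$ if for every vertex $v \in V - S$ there exist vertices $u_1, u_2 \in S$ (possibly equal) such that $(v,u_1)$ and $(u_2,v)$ are arcs of $D$. The twin domination number $\gamma^{*}(D)$ is the minimum cardinality of a twin dominating set of $D$. -}

module Defs where

open import Data.Nat using (ℕ; _≤_)
open import Data.Bool using (Bool; true; false)
open import Data.Fin using (Fin)
open import Data.Fin.Subset using (Subset; _∈_; _∉_; ∣_∣)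
open import Data.Vec using (tabulate)
open import Data.Product using (Σ; ∃; _×_; _,_)
open import Data.Sum using (_⊎_)
open import Relation.Binary.PropositionalEquality using (_≡_; _≢_)

-- A digraph on vertex set Fin n, given by its (decidable) arc relation:
-- (u , v) ∈ A  iff  arc u v ≡ true.
Digraph : ℕ → Set
Digraph n = Fin n → Fin n → Bool

record IsTournament {n : ℕ} (D : Digraph n) : Set where
  field
    irreflexive : ∀ v → D v v ≡ false
    total       : ∀ u v → u ≢ v → (D u v ≡ true) ⊎ (D v u ≡ true)
    asymmetric  : ∀ u v → D u v ≡ true → D v u ≡ false

inNbhd : ∀ {n} → Digraph n → Fin n → Subset n
inNbhd D v = tabulate (λ u → D u v)

outNbhd : ∀ {n} → Digraph n → Fin n → Subset n
outNbhd D v = tabulate (λ u → D v u)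

indeg : ∀ {n} → Digraph n → Fin n → ℕ
indeg D v = ∣ inNbhd D v ∣

outdeg : ∀ {n} → Digraph n → Fin n → ℕ
outdeg D v = ∣ outNbhd D v ∣

IsTwinDominating : ∀ {n} → Digraph n → Subset n → Set
IsTwinDominating {n} D S =
  ∀ (v : Fin n) → v ∉ S →
    (Σ (Fin n) λ u₁ → u₁ ∈ S × D v u₁ ≡ true) ×
    (Σ (Fin n) λ u₂ → u₂ ∈ S × D u₂ v ≡ true)

-- γ*(D) ≤ k  iff  some twin dominating set has cardinality ≤ k
-- (the minimum exists since V itself is twin dominating).
TwinDomNumber≤ : ∀ {n} → Digraph n → ℕ → Set
TwinDomNumber≤ {n} D k = Σ (Subset n) λ S → IsTwinDominating D S × ∣ S ∣ ≤ k

-- Let v have out-degree 2, say O(v) = {c, d} with d → c (for in-degree 2,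
-- reverse every arc).  The other five vertices all beat v.  Any tournament on
-- five vertices has a vertex x of in-degree at most 2 (the in-degrees sum to
-- 10), and x together with the winner y of the game between its in-neighbours
-- dominates the five.  Then {v, c, x, y} is twin dominating: d has v → d → c,
-- and each of the five enters v and is entered from x or y.
module Submission where

open import Defs
open import Data.Bool using (Bool; true; false)
open import Data.Empty using (⊥-elim)
open import Data.Fin using (Fin; zero; suc; punchIn; punchOut; _≟_)
open import Data.Fin.Properties as Fin using (any?; punchIn-injective; punchIn-punchOut)
open import Data.Fin.Subset using (Subset; inside; outside; _∈_; _∉_; ∣_∣; ⁅_⁆; _∪_)
open import Data.Fin.Subset.Properties using (x∈⁅x⁆; ∣⁅x⁆∣≡1; x∈p∪q⁺)
open import Data.Nat using (ℕ; zero; suc; _+_; _*_; _≤_; _<_; z≤n; s≤s; _≤?_)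
open import Data.Nat.Properties
  using (+-0-commutativeMonoid; +-suc; +-mono-≤; +-mono-≤-<; +-mono-<-≤; ≤-refl; ≤-reflexive; ≤-trans;
         <-≤-trans; <⇒≤; <-irrefl; +-identityʳ; m≤n⇒m≤1+n; *-cancelˡ-≤; ≰⇒>; suc-injective)
open import Data.Product using (Σ; ∃; ∃₂; _×_; _,_; proj₁; proj₂; swap)
open import Data.Sum using (_⊎_; inj₁; inj₂; [_,_]′) renaming (swap to ⊎-swap)
open import Data.Unit using (⊤; tt)
open import Data.Vec using ([]; _∷_; here; there; tabulate)
open import Data.Vec.Properties using (lookup∘tabulate; lookup⇒[]=; []=⇒lookup)
open import Function using (_∘_; id)
open import Function.Definitions using (Injective)
open import Relation.Nullary using (yes; no; contradiction)
open import Relation.Nullary.Decidable using (decidable-stable)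
open import Relation.Binary.PropositionalEquality
  using (_≡_; _≢_; refl; sym; trans; cong; cong₂; subst; module ≡-Reasoning)

open import Algebra.Properties.CommutativeMonoid.Sum +-0-commutativeMonoid
  using (sum; sum-syntax; ∑-comm; ∑-distrib-+; sum-cong-≗)

private
  variable
    m n : ℕ

𝟙 : Bool → ℕ
𝟙 true  = 1
𝟙 false = 0

𝟙+𝟙≤1 : {b c : Bool} → (b ≡ true → c ≡ false) → 𝟙 b + 𝟙 c ≤ 1
𝟙+𝟙≤1 {true}  {true}  b⇒¬c with () ← b⇒¬c refl
𝟙+𝟙≤1 {true}  {false} _ = ≤-refl
𝟙+𝟙≤1 {false} {true}  _ = ≤-refl
𝟙+𝟙≤1 {false} {false} _ = z≤n

∑-mono-≤ : {f g : Fin n → ℕ} → (∀ i → f i ≤ g i) → sum f ≤ sum g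
∑-mono-≤ {zero}  f≤g = z≤n
∑-mono-≤ {suc n} f≤g = +-mono-≤ (f≤g zero) (∑-mono-≤ (f≤g ∘ suc))

∑-mono-< : {f g : Fin (suc n) → ℕ} → (∀ i → f i < g i) → sum f < sum g
∑-mono-< f<g = +-mono-<-≤ (f<g zero) (∑-mono-≤ (<⇒≤ ∘ f<g ∘ suc))

∑≤n : (g : Fin n → ℕ) → (∀ u → g u ≤ 1) → sum g ≤ n
∑≤n {zero}  g g≤1 = z≤n
∑≤n {suc n} g g≤1 = +-mono-≤ (g≤1 zero) (∑≤n (g ∘ suc) (g≤1 ∘ suc))

∑<n : (g : Fin n → ℕ) (v : Fin n) → g v ≡ 0 → (∀ u → g u ≤ 1) → sum g < n
∑<n g zero    g0≡0 g≤1 = +-mono-<-≤ (subst (_< 1) (sym g0≡0) (s≤s z≤n)) (∑≤n (g ∘ suc) (g≤1 ∘ suc))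
∑<n g (suc v) gv≡0 g≤1 = +-mono-≤-< (g≤1 zero) (∑<n (g ∘ suc) v gv≡0 (g≤1 ∘ suc))

∈-tabulate⁺ : {f : Fin n → Bool} {u : Fin n} → f u ≡ true → u ∈ tabulate f
∈-tabulate⁺ {f = f} {u} fu≡true = lookup⇒[]= u (tabulate f) (trans (lookup∘tabulate f u) fu≡true)

∈-tabulate⁻ : {f : Fin n → Bool} {u : Fin n} → u ∈ tabulate f → f u ≡ true
∈-tabulate⁻ {f = f} {u} u∈ = trans (sym (lookup∘tabulate f u)) ([]=⇒lookup u∈)

∣tabulate∣≡∑ : (f : Fin n → Bool) → ∣ tabulate f ∣ ≡ ∑[ u < n ] 𝟙 (f u)
∣tabulate∣≡∑ {zero}  f = refl
∣tabulate∣≡∑ {suc n} f with f zero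
... | true  = cong suc (∣tabulate∣≡∑ (f ∘ suc))
... | false = ∣tabulate∣≡∑ (f ∘ suc)

∣p∪q∣≤∣p∣+∣q∣ : (p q : Subset n) → ∣ p ∪ q ∣ ≤ ∣ p ∣ + ∣ q ∣
∣p∪q∣≤∣p∣+∣q∣ []            []            = z≤n
∣p∪q∣≤∣p∣+∣q∣ (outside ∷ p) (outside ∷ q) = ∣p∪q∣≤∣p∣+∣q∣ p q
∣p∪q∣≤∣p∣+∣q∣ (inside  ∷ p) (outside ∷ q) = s≤s (∣p∪q∣≤∣p∣+∣q∣ p q)
∣p∪q∣≤∣p∣+∣q∣ (outside ∷ p) (inside  ∷ q) =
  subst (suc ∣ p ∪ q ∣ ≤_) (sym (+-suc ∣ p ∣ ∣ q ∣)) (s≤s (∣p∪q∣≤∣p∣+∣q∣ p q))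
∣p∪q∣≤∣p∣+∣q∣ (inside  ∷ p) (inside  ∷ q) =
  s≤s (subst (∣ p ∪ q ∣ ≤_) (sym (+-suc ∣ p ∣ ∣ q ∣)) (m≤n⇒m≤1+n (∣p∪q∣≤∣p∣+∣q∣ p q)))

∣p∣≡0⇒x∉p : {p : Subset n} {x : Fin n} → ∣ p ∣ ≡ 0 → x ∉ p
∣p∣≡0⇒x∉p {p = outside ∷ p} ∣p∣≡0 (there x∈p) = ∣p∣≡0⇒x∉p ∣p∣≡0 x∈p

∣p∣≡1⇒ : {p : Subset n} → ∣ p ∣ ≡ 1 → ∃ λ a → a ∈ p × (∀ {x} → x ∈ p → x ≡ a)
∣p∣≡1⇒ {p = outside ∷ p} ∣p∣≡1 with ∣p∣≡1⇒ ∣p∣≡1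
... | a , a∈p , only-a = suc a , there a∈p , λ { (there x∈p) → cong suc (only-a x∈p) }
∣p∣≡1⇒ {p = inside  ∷ p} ∣p∣≡1 =
  zero , here , λ { here → refl ; (there x∈p) → ⊥-elim (∣p∣≡0⇒x∉p (suc-injective ∣p∣≡1) x∈p) }

∣p∣≡2⇒ : {p : Subset n} → ∣ p ∣ ≡ 2 →
  ∃₂ λ a b → a ≢ b × a ∈ p × b ∈ p × (∀ {x} → x ∈ p → x ≡ a ⊎ x ≡ b)
∣p∣≡2⇒ {p = outside ∷ p} ∣p∣≡2 with ∣p∣≡2⇒ ∣p∣≡2
... | a , b , a≢b , a∈p , b∈p , only-ab =
  suc a , suc b , a≢b ∘ Fin.suc-injective , there a∈p , there b∈p ,
  λ { (there x∈p) → [ inj₁ ∘ cong suc , inj₂ ∘ cong suc ]′ (only-ab x∈p) }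
∣p∣≡2⇒ {p = inside  ∷ p} ∣p∣≡2 with ∣p∣≡1⇒ (suc-injective ∣p∣≡2)
... | b , b∈p , only-b =
  zero , suc b , (λ ()) , here , there b∈p , λ { here → inj₁ refl ; (there x∈p) → inj₂ (cong suc (only-b x∈p)) }

∣p∣≤2⇒ : {p : Subset n} → Fin n → ∣ p ∣ ≤ 2 → ∃₂ λ a b → ∀ {x} → x ∈ p → x ≡ a ⊎ x ≡ b
∣p∣≤2⇒ {p = p} z ∣p∣≤2 with ∣ p ∣ in ∣p∣≡
∣p∣≤2⇒ z _ | 0 = z , z , ⊥-elim ∘ ∣p∣≡0⇒x∉p ∣p∣≡
∣p∣≤2⇒ z _ | 1 with ∣p∣≡1⇒ ∣p∣≡
... | a , _ , only-a = a , a , inj₁ ∘ only-a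
∣p∣≤2⇒ z _ | 2 with ∣p∣≡2⇒ ∣p∣≡
... | a , b , _ , _ , _ , only-ab = a , b , only-ab
∣p∣≤2⇒ z (s≤s (s≤s ())) | suc (suc (suc _))

∑indeg≡∑outdeg : (D : Digraph n) → sum (indeg D) ≡ sum (outdeg D)
∑indeg≡∑outdeg {n} D = begin
  sum (indeg D)                     ≡⟨ sum-cong-≗ (λ v → ∣tabulate∣≡∑ (λ u → D u v)) ⟩
  ∑[ v < n ] ∑[ u < n ] 𝟙 (D u v)  ≡⟨ ∑-comm (λ v u → 𝟙 (D u v)) ⟩
  ∑[ u < n ] ∑[ v < n ] 𝟙 (D u v)  ≡⟨ sum-cong-≗ (λ u → ∣tabulate∣≡∑ (D u)) ⟨
  sum (outdeg D)                    ∎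
  where open ≡-Reasoning

module _ {D : Digraph n} (tour : IsTournament D) where
  open IsTournament tour

  arc⇒≢ : {a b : Fin n} → D a b ≡ true → b ≢ a
  arc⇒≢ {a} ab refl with () ← trans (sym ab) (irreflexive a)

  indeg+outdeg<n : ∀ v → indeg D v + outdeg D v < n
  indeg+outdeg<n v = subst (_< n) (sym degrees) (∑<n _ v no-loop at-most-one-arc)
    where
    degrees : indeg D v + outdeg D v ≡ ∑[ u < n ] (𝟙 (D u v) + 𝟙 (D v u))
    degrees = trans (cong₂ _+_ (∣tabulate∣≡∑ (λ u → D u v)) (∣tabulate∣≡∑ (D v)))
                    (sym (∑-distrib-+ (λ u → 𝟙 (D u v)) (λ u → 𝟙 (D v u))))
    no-loop : 𝟙 (D v v) + 𝟙 (D v v) ≡ 0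
    no-loop = cong (λ b → 𝟙 b + 𝟙 b) (irreflexive v)
    at-most-one-arc : ∀ u → 𝟙 (D u v) + 𝟙 (D v u) ≤ 1
    at-most-one-arc u = 𝟙+𝟙≤1 (asymmetric u v)

∃-2*indeg≤n : {D : Digraph (suc n)} → IsTournament D → ∃ λ v → 2 * indeg D v ≤ n
∃-2*indeg≤n {n} {D} tour = decidable-stable (any? (λ v → 2 * indeg D v ≤? n)) λ none →
  <-irrefl sum-in+out≡sum-2*in (∑-mono-< λ v → <-≤-trans (indeg+outdeg<n tour v) (≰⇒> (none ∘ (v ,_))))
  where
  open ≡-Reasoning
  sum-in+out≡sum-2*in : ∑[ v < suc n ] (indeg D v + outdeg D v) ≡ ∑[ v < suc n ] (2 * indeg D v)
  sum-in+out≡sum-2*in = begin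
    ∑[ v < suc n ] (indeg D v + outdeg D v)  ≡⟨ ∑-distrib-+ (indeg D) (outdeg D) ⟩
    sum (indeg D) + sum (outdeg D)           ≡⟨ cong (sum (indeg D) +_) (∑indeg≡∑outdeg D) ⟨
    sum (indeg D) + sum (indeg D)            ≡⟨ ∑-distrib-+ (indeg D) (indeg D) ⟨
    ∑[ v < suc n ] (indeg D v + indeg D v)   ≡⟨ sum-cong-≗ (λ v → cong (indeg D v +_) (+-identityʳ (indeg D v))) ⟨
    ∑[ v < suc n ] (2 * indeg D v)           ∎

DominatingPair : Digraph n → Fin n → Fin n → Set
DominatingPair D x y = ∀ u → u ≢ x → u ≢ y → D x u ≡ true ⊎ D y u ≡ true

module _ {D : Digraph n} (tour : IsTournament D) where
  open IsTournament tour

  beats-inNbhd⇒dominatingPair : (x y : Fin n) →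
    (∀ {u} → u ∈ inNbhd D x → u ≢ y → D y u ≡ true) → DominatingPair D x y
  beats-inNbhd⇒dominatingPair x y beats u u≢x u≢y with total x u (u≢x ∘ sym)
  ... | inj₁ xu = inj₁ xu
  ... | inj₂ ux = inj₂ (beats (∈-tabulate⁺ ux) u≢y)

  inNbhd⊆⇒dominatingPair : (x a b : Fin n) → (∀ {u} → u ∈ inNbhd D x → u ≡ a ⊎ u ≡ b) →
    ∃ (DominatingPair D x)
  inNbhd⊆⇒dominatingPair x a b only-ab with a ≟ b
  ... | yes refl = a , beats-inNbhd⇒dominatingPair x a λ u∈ u≢a →
    ⊥-elim ([ u≢a , u≢a ]′ (only-ab u∈))
  ... | no a≢b with total a b a≢b
  ...   | inj₁ ab = a , beats-inNbhd⇒dominatingPair x a λ u∈ u≢a →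
    [ (λ u≡a → contradiction u≡a u≢a) , (λ { refl → ab }) ]′ (only-ab u∈)
  ...   | inj₂ ba = b , beats-inNbhd⇒dominatingPair x b λ u∈ u≢b →
    [ (λ { refl → ba }) , (λ u≡b → contradiction u≡b u≢b) ]′ (only-ab u∈)

  indeg≤2⇒dominatingPair : (x : Fin n) → indeg D x ≤ 2 → ∃ (DominatingPair D x)
  indeg≤2⇒dominatingPair x indeg≤2 with ∣p∣≤2⇒ x indeg≤2
  ... | a , b , only-ab = inNbhd⊆⇒dominatingPair x a b only-ab

tournament₅-dominatingPair : {D : Digraph 5} → IsTournament D → ∃₂ (DominatingPair D)
tournament₅-dominatingPair {D} tour =
  let x , 2*indeg≤4 = ∃-2*indeg≤n tour
  in  x , indeg≤2⇒dominatingPair tour x (*-cancelˡ-≤ {indeg D x} {2} 2 2*indeg≤4)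

Enumeration : (m : ℕ) → (Fin n → Set) → Set
Enumeration {n} m P = Σ (Fin m → Fin n) λ w → Injective _≡_ _≡_ w × (∀ {u} → P u → ∃ λ i → w i ≡ u)

enumeration-all : Enumeration n (λ _ → ⊤)
enumeration-all = id , id , λ {u} _ → u , refl

enumeration-remove : {P : Fin n → Set} {a : Fin n} →
  Enumeration (suc m) P → P a → Enumeration m (λ u → P u × u ≢ a)
enumeration-remove {P = P} {a} (w , w-inj , w-onto) Pa with w-onto Pa
... | j , wj≡a = w ∘ punchIn j , punchIn-injective j _ _ ∘ w-inj , onto
  where
  onto : ∀ {u} → P u × u ≢ a → ∃ λ i → w (punchIn j i) ≡ u
  onto (Pu , u≢a) with w-onto Pu
  ... | i , wi≡u = punchOut j≢i , trans (cong w (punchIn-punchOut j≢i)) wi≡u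
    where
    j≢i : j ≢ i
    j≢i refl = u≢a (trans (sym wi≡u) wj≡a)

induced : (Fin m → Fin n) → Digraph n → Digraph m
induced w D i j = D (w i) (w j)

induced-isTournament : {w : Fin m → Fin n} {D : Digraph n} →
  Injective _≡_ _≡_ w → IsTournament D → IsTournament (induced w D)
induced-isTournament {w = w} w-inj tour = record
  { irreflexive = λ i → irreflexive (w i)
  ; total       = λ i j i≢j → total (w i) (w j) (i≢j ∘ w-inj)
  ; asymmetric  = λ i j → asymmetric (w i) (w j)
  }
  where open IsTournament tour

dominatingPair-lift : {w : Fin m → Fin n} {D : Digraph n} {i j : Fin m} →
  DominatingPair (induced w D) i j →
  ∀ {u} → (∃ λ k → w k ≡ u) → u ≢ w i → u ≢ w j → D (w i) u ≡ true ⊎ D (w j) u ≡ true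
dominatingPair-lift {w = w} dominating (k , refl) wk≢wi wk≢wj =
  dominating k (wk≢wi ∘ cong w) (wk≢wj ∘ cong w)

reverse : Digraph n → Digraph n
reverse D u v = D v u

reverse-isTournament : {D : Digraph n} → IsTournament D → IsTournament (reverse D)
reverse-isTournament tour = record
  { irreflexive = irreflexive
  ; total       = λ u v u≢v → ⊎-swap (total u v u≢v)
  ; asymmetric  = λ u v → asymmetric v u
  }
  where open IsTournament tour

twinDominating-reverse : {D : Digraph n} {S : Subset n} →
  IsTwinDominating (reverse D) S → IsTwinDominating D S
twinDominating-reverse twin v v∉S = swap (twin v v∉S)

quartet : Fin n → Fin n → Fin n → Fin n → Subset n
quartet a b c d = ⁅ a ⁆ ∪ ⁅ b ⁆ ∪ ⁅ c ⁆ ∪ ⁅ d ⁆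

∣quartet∣≤4 : (a b c d : Fin n) → ∣ quartet a b c d ∣ ≤ 4
∣quartet∣≤4 a b c d =
  ≤-trans (∣⁅x⁆∪p∣≤1+∣p∣ a _) (s≤s (≤-trans (∣⁅x⁆∪p∣≤1+∣p∣ b _) (s≤s (≤-trans (∣⁅x⁆∪p∣≤1+∣p∣ c _)
    (s≤s (≤-reflexive (∣⁅x⁆∣≡1 d)))))))
  where
  ∣⁅x⁆∪p∣≤1+∣p∣ : (x : Fin n) (p : Subset n) → ∣ ⁅ x ⁆ ∪ p ∣ ≤ suc ∣ p ∣
  ∣⁅x⁆∪p∣≤1+∣p∣ x p = subst (λ k → ∣ ⁅ x ⁆ ∪ p ∣ ≤ k + ∣ p ∣) (∣⁅x⁆∣≡1 x) (∣p∪q∣≤∣p∣+∣q∣ ⁅ x ⁆ p)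

∈quartet : (a b c d : Fin n) →
  let Q = quartet a b c d in a ∈ Q × b ∈ Q × c ∈ Q × d ∈ Q
∈quartet a b c d =
  x∈p∪q⁺ (inj₁ (x∈⁅x⁆ a)) ,
  x∈p∪q⁺ (inj₂ (x∈p∪q⁺ (inj₁ (x∈⁅x⁆ b)))) ,
  x∈p∪q⁺ (inj₂ (x∈p∪q⁺ (inj₂ (x∈p∪q⁺ (inj₁ (x∈⁅x⁆ c)))))) ,
  x∈p∪q⁺ (inj₂ (x∈p∪q⁺ (inj₂ (x∈p∪q⁺ (inj₂ (x∈⁅x⁆ d))))))

∉quartet : {a b c d u : Fin n} → u ∉ quartet a b c d → u ≢ a × u ≢ b × u ≢ c × u ≢ d
∉quartet {a = a} {b} {c} {d} u∉Q with ∈quartet a b c d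
... | a∈Q , b∈Q , c∈Q , d∈Q =
  (λ { refl → u∉Q a∈Q }) , (λ { refl → u∉Q b∈Q }) , (λ { refl → u∉Q c∈Q }) , (λ { refl → u∉Q d∈Q })

quartet-twinDominating : {T : Digraph n} {v c d x y : Fin n} → T v d ≡ true → T d c ≡ true →
  (∀ u → u ≢ v → u ≢ c → u ≢ d → T u v ≡ true × (u ≢ x → u ≢ y → T x u ≡ true ⊎ T y u ≡ true)) →
  IsTwinDominating T (quartet v c x y)
quartet-twinDominating {v = v} {c} {d} {x} {y} vd dc others u u∉S
  with ∈quartet v c x y | ∉quartet u∉S | u ≟ d
... | v∈S , c∈S , _ , _ | _ | yes refl = (c , c∈S , dc) , (v , v∈S , vd)
... | v∈S , _ , x∈S , y∈S | u≢v , u≢c , u≢x , u≢y | no u≢d with others u u≢v u≢c u≢d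
...   | uv , dominated = (v , v∈S , uv) ,
  [ (λ xu → x , x∈S , xu) , (λ yu → y , y∈S , yu) ]′ (dominated u≢x u≢y)

module _ {T : Digraph 8} (tour : IsTournament T) where
  open IsTournament tour

  outNbhd≡pair⇒γ*≤4 : {v c d : Fin 8} → T v c ≡ true → T v d ≡ true → T d c ≡ true →
    (∀ {u} → T v u ≡ true → u ≡ c ⊎ u ≡ d) → TwinDomNumber≤ T 4
  outNbhd≡pair⇒γ*≤4 {v} {c} {d} vc vd dc only-cd =
    quartet v c (w i) (w j) ,
    quartet-twinDominating {T = T} {v} {c} {d} {w i} {w j} vd dc others ,
    ∣quartet∣≤4 v c (w i) (w j)
    where
    enumeration : Enumeration 5 λ u → ((⊤ × u ≢ v) × u ≢ d) × u ≢ c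
    enumeration = enumeration-remove (enumeration-remove (enumeration-remove enumeration-all tt)
      (tt , arc⇒≢ tour vd)) ((tt , arc⇒≢ tour vc) , arc⇒≢ tour dc)
    w : Fin 5 → Fin 8
    w = proj₁ enumeration
    w-inj : Injective _≡_ _≡_ w
    w-inj = proj₁ (proj₂ enumeration)
    w-onto : ∀ {u} → ((⊤ × u ≢ v) × u ≢ d) × u ≢ c → ∃ λ k → w k ≡ u
    w-onto = proj₂ (proj₂ enumeration)
    pair : ∃₂ (DominatingPair (induced w T))
    pair = tournament₅-dominatingPair (induced-isTournament w-inj tour)
    i j : Fin 5
    i = proj₁ pair
    j = proj₁ (proj₂ pair)
    others : ∀ u → u ≢ v → u ≢ c → u ≢ d →
      T u v ≡ true × (u ≢ w i → u ≢ w j → T (w i) u ≡ true ⊎ T (w j) u ≡ true)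
    others u u≢v u≢c u≢d =
      [ id , (λ vu → ⊥-elim ([ u≢c , u≢d ]′ (only-cd vu))) ]′ (total u v u≢v) ,
      dominatingPair-lift {w = w} {T} {i} {j} (proj₂ (proj₂ pair))
        (w-onto (((tt , u≢v) , u≢d) , u≢c))

  outdeg≡2⇒γ*≤4 : (v : Fin 8) → outdeg T v ≡ 2 → TwinDomNumber≤ T 4
  outdeg≡2⇒γ*≤4 v outdeg≡2 with ∣p∣≡2⇒ {p = outNbhd T v} outdeg≡2
  ... | a , b , a≢b , a∈O , b∈O , only-ab with total a b a≢b
  ...   | inj₁ ab = outNbhd≡pair⇒γ*≤4 (∈-tabulate⁻ {f = T v} b∈O) (∈-tabulate⁻ {f = T v} a∈O) ab
                      (⊎-swap ∘ only-ab ∘ ∈-tabulate⁺ {f = T v})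
  ...   | inj₂ ba = outNbhd≡pair⇒γ*≤4 (∈-tabulate⁻ {f = T v} a∈O) (∈-tabulate⁻ {f = T v} b∈O) ba
                      (only-ab ∘ ∈-tabulate⁺ {f = T v})

theorem2p2 : (T : Digraph 8) → IsTournament T →
    Σ (Fin 8) (λ v → (indeg T v ≡ 2) ⊎ (outdeg T v ≡ 2)) →
    TwinDomNumber≤ T 4
theorem2p2 T tour (v , inj₂ outdeg≡2) = outdeg≡2⇒γ*≤4 tour v outdeg≡2
theorem2p2 T tour (v , inj₁ indeg≡2) with outdeg≡2⇒γ*≤4 (reverse-isTournament tour) v indeg≡2
... | S , twin , ∣S∣≤4 = S , twinDominating-reverse twin , ∣S∣≤4
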